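{- Let $DP_3$ be the directed path on 3 vertices and \[\operatorname{aind}(DP_3)=\limsup_{n\to\infty}\max_{H}\frac{N_{\mathrm{ind}}(DP_3,H)}{\binom{n}{3}},\] where the maximum is over all directed acyclic graphs $H$ on $n$ vertices and $N_{\mathrm{ind}}(DP_3,H)$ is the number of induced copies of $DP_3$ in $H$. Then $\operatorname{aind}(DP_3)=\frac14$. -}

module Defs where

open import Data.Nat using (ℕ; suc; zero)
open import Data.Nat.Combinatorics using (_C_)
open import Data.Fin using (Fin; _≟_)
open import Data.Bool using (Bool; true; false; _∧_; not; T)
open import Data.List using (List; allFin; filter; length; concatMap; map; _∷_; [])
open import Data.Product using (_×_; _,_)
open import Data.Integer using (+_)
open import Data.Rational using (ℚ; _/_; _+_; _-_; _*_; _≤_)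
open import Relation.Nullary using (¬_; does)
open import Relation.Nullary.Decidable using (T?)

Digraph : ℕ → Set
Digraph n = Fin n → Fin n → Bool

data Walk⁺ {n : ℕ} (E : Digraph n) : Fin n → Fin n → Set where
  arc  : ∀ {u v} → T (E u v) → Walk⁺ E u v
  _∷ʷ_ : ∀ {u v w} → T (E u v) → Walk⁺ E v w → Walk⁺ E u w

-- A directed acyclic graph: there is no directed cycle (closed walk of
-- positive length; this also excludes loops).
IsDAG : ∀ {n} → Digraph n → Set
IsDAG {n} E = ∀ (v : Fin n) → ¬ Walk⁺ E v v

neq : ∀ {n} → Fin n → Fin n → Bool
neq a b = not (does (a ≟ b))

isInducedDP3 : ∀ {n} → Digraph n → Fin n → Fin n → Fin n → Bool
isInducedDP3 E a b c =
  neq a b ∧ neq b c ∧ neq a c ∧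
  E a b ∧ E b c ∧
  not (E b a) ∧ not (E c b) ∧ not (E a c) ∧ not (E c a)

triples : ∀ n → List (Fin n × Fin n × Fin n)
triples n = concatMap (λ a → concatMap (λ b → map (λ c → (a , b , c)) (allFin n)) (allFin n)) (allFin n)

-- Since DP₃ has
-- trivial automorphism group, induced copies correspond bijectively to
-- ordered triples (a,b,c) inducing exactly the arcs a→b, b→c.
Nind-DP3 : ∀ {n} → Digraph n → ℕ
Nind-DP3 {n} E =
  length (filter (λ { (a , b , c) → T? (isInducedDP3 E a b c) }) (triples n))

ℕ→ℚ : ℕ → ℚ
ℕ→ℚ k = + k / 1

quarter : ℚ
quarter = + 1 / 4

-- Number the vertices of the DAG so that arcs go forward.  For y ≠ x put τ(y,x) = +1 if
-- "x comes before y" and "x, y are adjacent" are both true or both false, and τ(y,x) = −1 otherwise;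
-- τ(y,y) = 0.  Then 0 ≤ Σ_y (Σ_x τ(y,x))² = Σ_{x,y,z} τ(y,x)τ(y,z).  For three distinct points the sum
-- of the three rotations τ(y,x)τ(y,z) + τ(z,y)τ(z,x) + τ(x,z)τ(x,y) is −3 when {x,y,z} induces a DP₃
-- and at most 1 in every case, so adding 4 times the number of orderings in which (x,y,z) is an induced
-- path bounds every ordered triple's contribution by 1.  Summing over all n³ triples gives 24·N ≤ n³.
--
-- On 0, …, n−1 put u → v when u < v and u, v have opposite parity.  Then every path
-- a → b → c is induced (a and c have the same parity), and b has at least b/2 in-neighbours and
-- (n−1−b)/2 out-neighbours, so 4·N ≥ Σ_b b(n−1−b) = C(n,3).

module Submission where

open import Defs

module TopologicalOrder where

  open import Data.Bool using (true; false; T; if_then_else_)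
  open import Data.Empty using (⊥-elim)
  open import Data.Fin using (Fin; zero; suc; toℕ)
  open import Data.Fin.Properties using (pigeonhole; toℕ<n; toℕ-injective)
  open import Data.Nat using (ℕ; zero; suc; _+_; _*_; _≤_; _<_; _⊔_; z≤n; s≤s)
  open import Data.Nat.Properties
  open import Data.Product using (∃; _,_)
  open import Data.Sum using (_⊎_; inj₁; inj₂)
  open import Relation.Binary.Definitions using (tri<; tri≈; tri>)
  open import Relation.Binary.PropositionalEquality
  open import Relation.Nullary using (¬_)

  maximum : ∀ {m} → (Fin m → ℕ) → ℕ
  maximum {zero}  g = 0
  maximum {suc m} g = g zero ⊔ maximum (λ i → g (suc i))

  ≤-maximum : ∀ {m} (g : Fin m → ℕ) i → g i ≤ maximum g
  ≤-maximum g zero    = m≤m⊔n _ _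
  ≤-maximum g (suc i) = ≤-trans (≤-maximum (λ j → g (suc j)) i) (m≤n⊔m _ _)

  maximum-≤ : ∀ {m k} (g : Fin m → ℕ) → (∀ i → g i ≤ k) → maximum g ≤ k
  maximum-≤ {zero}  g g≤k = z≤n
  maximum-≤ {suc m} g g≤k = ⊔-lub (g≤k zero) (maximum-≤ (λ i → g (suc i)) (λ i → g≤k (suc i)))

  maximum-attained : ∀ {m} (g : Fin m → ℕ) → maximum g ≡ 0 ⊎ ∃ λ i → maximum g ≡ g i
  maximum-attained {zero}  g = inj₁ refl
  maximum-attained {suc m} g with ⊔-sel (g zero) (maximum (λ i → g (suc i)))
  ... | inj₁ eq = inj₂ (zero , eq)
  ... | inj₂ eq with maximum-attained (λ i → g (suc i))
  ...   | inj₁ eq₀       = inj₁ (trans eq eq₀)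
  ...   | inj₂ (i , eqᵢ) = inj₂ (suc i , trans eq eqᵢ)

  record TopologicalNumbering {n : ℕ} (E : Digraph n) : Set where
    field
      number     : Fin n → ℕ
      injective  : ∀ {u v} → number u ≡ number v → u ≡ v
      increasing : ∀ {u v} → T (E u v) → number u < number v

  module Depth {n : ℕ} (E : Digraph n) where

    record BackWalk (k : ℕ) (v : Fin n) : Set where
      field
        vertex : ℕ → Fin n
        start  : vertex 0 ≡ v
        step   : ∀ i → i < k → T (E (vertex (suc i)) (vertex i))

    open BackWalk

    stay : ∀ {v} → BackWalk 0 v
    stay {v} = record { vertex = λ _ → v ; start = refl ; step = λ _ () }

    _◃_ : ∀ {k u v} → BackWalk k u → T (E u v) → BackWalk (suc k) v
    _◃_ {v = v} w e = record { vertex = vertex′ ; start = refl ; step = step′ }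
      where
      vertex′ : ℕ → Fin n
      vertex′ zero    = v
      vertex′ (suc i) = vertex w i
      step′ : ∀ i → i < suc _ → T (E (vertex′ (suc i)) (vertex′ i))
      step′ zero    _         = subst (λ u → T (E u v)) (sym (start w)) e
      step′ (suc i) (s≤s i<k) = step w i i<k

    segment : ∀ {k v} (w : BackWalk k v) {i j} → i < j → j ≤ k → Walk⁺ E (vertex w j) (vertex w i)
    segment w {i} {suc j} (s≤s i≤j) j<k with m≤n⇒m<n∨m≡n i≤j
    ... | inj₁ i<j  = step w j j<k ∷ʷ segment w i<j (<⇒≤ j<k)
    ... | inj₂ refl = arc (step w j j<k)

    no-long-walk : IsDAG E → ∀ {v} → ¬ BackWalk (suc n) v
    no-long-walk dag w with pigeonhole (n<1+n n) (λ (i : Fin (suc n)) → vertex w (toℕ i))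
    ... | i , j , i<j , same =
      dag (vertex w (toℕ i)) (subst (λ u → Walk⁺ E u (vertex w (toℕ i))) (sym same)
                                (segment w i<j (<⇒≤ (toℕ<n j))))

    depth : ℕ → Fin n → ℕ
    depth zero    v = 0
    depth (suc k) v = maximum λ u → if E u v then suc (depth k u) else 0

    depth-≤ : ∀ k v → depth k v ≤ k
    depth-≤ zero    v = z≤n
    depth-≤ (suc k) v = maximum-≤ _ bound
      where
      bound : ∀ u → (if E u v then suc (depth k u) else 0) ≤ suc k
      bound u with E u v
      ... | true  = s≤s (depth-≤ k u)
      ... | false = z≤n

    depth-arc : ∀ k {u v} → T (E u v) → suc (depth k u) ≤ depth (suc k) v
    depth-arc k {u} {v} e = ≤-trans (at-arc (E u v) e) (≤-maximum (λ u → if E u v then suc (depth k u) else 0) u)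
      where
      at-arc : ∀ b → T b → suc (depth k u) ≤ (if b then suc (depth k u) else 0)
      at-arc true _ = ≤-refl

    walk-≤-depth : ∀ {j k v} → BackWalk j v → j ≤ k → j ≤ depth k v
    walk-≤-depth {zero}  w _ = z≤n
    walk-≤-depth {suc j} {suc k} {v} w (s≤s j≤k) =
      subst (λ x → suc j ≤ depth (suc k) x) (start w)
        (≤-trans (s≤s (walk-≤-depth tail j≤k)) (depth-arc k (step w 0 (s≤s z≤n))))
      where
      tail : BackWalk j (vertex w 1)
      tail = record { vertex = λ i → vertex w (suc i) ; start = refl ; step = λ i i<j → step w (suc i) (s≤s i<j) }

    depth-walk : ∀ k v → BackWalk (depth k v) v
    depth-walk zero    v = stay
    depth-walk (suc k) v with maximum-attained (λ u → if E u v then suc (depth k u) else 0)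
    ... | inj₁ eq₀ rewrite eq₀ = stay
    ... | inj₂ (u , eq) rewrite eq = through (E u v) refl
      where
      through : ∀ b → E u v ≡ b → BackWalk (if b then suc (depth k u) else 0) v
      through true  e = depth-walk k u ◃ subst T (sym e) _
      through false _ = stay

    depth-increasing : IsDAG E → ∀ {u v} → T (E u v) → depth n u < depth n v
    depth-increasing dag {u} {v} e with m≤n⇒m<n∨m≡n (depth-≤ n u)
    ... | inj₁ short = walk-≤-depth (depth-walk n u ◃ e) short
    ... | inj₂ long  = ⊥-elim (no-long-walk dag (subst (λ j → BackWalk (suc j) v) long (depth-walk n u ◃ e)))

  topologicalNumbering : ∀ {n} {E : Digraph n} → IsDAG E → TopologicalNumbering E
  topologicalNumbering {n} {E} dag = record
    { number = number ; injective = injective ; increasing = λ e → lex (depth-increasing dag e) }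
    where
    open Depth E
    number : Fin n → ℕ
    number u = depth n u * n + toℕ u

    lex : ∀ {u v} → depth n u < depth n v → number u < number v
    lex {u} {v} lt = begin-strict
      depth n u * n + toℕ u  <⟨ +-monoʳ-< (depth n u * n) (toℕ<n u) ⟩
      depth n u * n + n      ≡⟨ +-comm (depth n u * n) n ⟩
      suc (depth n u) * n    ≤⟨ *-monoˡ-≤ n lt ⟩
      depth n v * n          ≤⟨ m≤m+n (depth n v * n) (toℕ v) ⟩
      number v               ∎
      where open ≤-Reasoning

    injective : ∀ {u v} → number u ≡ number v → u ≡ v
    injective {u} {v} eq with <-cmp (depth n u) (depth n v)
    ... | tri< lt _ _ = ⊥-elim (<-irrefl eq (lex lt))
    ... | tri> _ _ gt = ⊥-elim (<-irrefl (sym eq) (lex gt))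
    ... | tri≈ _ same _ = toℕ-injective (+-cancelˡ-≡ (depth n u * n) _ _
                            (trans eq (cong (λ d → d * n + toℕ v) (sym same))))

module Counting where

  open import Level using (Level)
  open import Data.Bool using (Bool; true; false; T; not; _∧_)
  open import Data.Bool.Properties using (T-∧)
  open import Data.Empty using (⊥-elim)
  open import Data.Fin using (Fin; zero; suc; _≟_)
  open import Data.List using (List; []; _∷_; _++_; length; filter; concat; concatMap; map; tabulate; allFin)
  open import Data.List.Properties using (map-tabulate)
  open import Data.Nat using (ℕ; zero; suc; _+_)
  open import Data.Nat.Properties using (+-*-semiring)
  open import Data.Product using (_×_; _,_; proj₁; proj₂)
  open import Function using (_∘_; id; Equivalence)
  open import Relation.Binary.PropositionalEquality
  open import Relation.Nullary using (¬_; does; yes; no)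
  open import Relation.Unary using (Pred; Decidable)
  open import Algebra.Properties.Semiring.Sum +-*-semiring using (sum-cong-≗; sum-syntax)

  ∧-intro : ∀ {a b} → T a → T b → T (a ∧ b)
  ∧-intro p q = Equivalence.from T-∧ (p , q)

  ∧-elimˡ : ∀ {a b} → T (a ∧ b) → T a
  ∧-elimˡ = proj₁ ∘ Equivalence.to T-∧

  ∧-elimʳ : ∀ {a b} → T (a ∧ b) → T b
  ∧-elimʳ = proj₂ ∘ Equivalence.to T-∧

  neq-refl : ∀ {n} (x : Fin n) → neq x x ≡ false
  neq-refl x with x ≟ x
  ... | yes _  = refl
  ... | no x≢x = ⊥-elim (x≢x refl)

  neq-true : ∀ {n} {x y : Fin n} → x ≢ y → neq x y ≡ true
  neq-true {x = x} {y} x≢y with x ≟ y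
  ... | yes x≡y = ⊥-elim (x≢y x≡y)
  ... | no _    = refl

  isInducedDP3-intro : ∀ {n} {E : Digraph n} {a b c} → a ≢ b → b ≢ c → a ≢ c →
    T (E a b) → T (E b c) → ¬ T (E b a) → ¬ T (E c b) → ¬ T (E a c) → ¬ T (E c a) →
    T (isInducedDP3 E a b c)
  isInducedDP3-intro a≢b b≢c a≢c ab bc ¬ba ¬cb ¬ac ¬ca =
    ∧-intro (distinct a≢b) (∧-intro (distinct b≢c) (∧-intro (distinct a≢c) (∧-intro ab (∧-intro bc
    (∧-intro (absent ¬ba) (∧-intro (absent ¬cb) (∧-intro (absent ¬ac) (absent ¬ca))))))))
    where
    distinct : ∀ {x y} → x ≢ y → T (neq x y)
    distinct x≢y = subst T (sym (neq-true x≢y)) _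
    absent : ∀ {x} → ¬ T x → T (not x)
    absent {true}  ¬x = ¬x _
    absent {false} ¬x = _

  𝟙 : Bool → ℕ
  𝟙 true  = 1
  𝟙 false = 0

  module _ {a p : Level} {A : Set a} {P : Pred A p} (P? : Decidable P) where

    length-filter-++ : ∀ xs ys → length (filter P? (xs ++ ys)) ≡ length (filter P? xs) + length (filter P? ys)
    length-filter-++ []       ys = refl
    length-filter-++ (x ∷ xs) ys with does (P? x)
    ... | true  = cong suc (length-filter-++ xs ys)
    ... | false = length-filter-++ xs ys

    length-filter-tabulate : ∀ {m} (f : Fin m → A) → length (filter P? (tabulate f)) ≡ ∑[ i < m ] 𝟙 (does (P? (f i)))
    length-filter-tabulate {zero}  f = refl
    length-filter-tabulate {suc m} f with does (P? (f zero))
    ... | true  = cong suc (length-filter-tabulate (f ∘ suc))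
    ... | false = length-filter-tabulate (f ∘ suc)

    length-filter-concat : ∀ {m} (f : Fin m → List A) →
      length (filter P? (concat (tabulate f))) ≡ ∑[ i < m ] length (filter P? (f i))
    length-filter-concat {zero}  f = refl
    length-filter-concat {suc m} f =
      trans (length-filter-++ (f zero) _) (cong (length (filter P? (f zero)) +_) (length-filter-concat (f ∘ suc)))

    length-filter-map : ∀ {m} (f : Fin m → A) → length (filter P? (map f (allFin m))) ≡ ∑[ i < m ] 𝟙 (does (P? (f i)))
    length-filter-map f = trans (cong (length ∘ filter P?) (map-tabulate id f)) (length-filter-tabulate f)

    length-filter-concatMap : ∀ {m} (f : Fin m → List A) →
      length (filter P? (concatMap f (allFin m))) ≡ ∑[ i < m ] length (filter P? (f i))
    length-filter-concatMap f =
      trans (cong (length ∘ filter P? ∘ concat) (map-tabulate id f)) (length-filter-concat f)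

  length-filter-triples : ∀ {n p} {P : Pred (Fin n × Fin n × Fin n) p} (P? : Decidable P) →
    length (filter P? (triples n)) ≡ ∑[ a < n ] ∑[ b < n ] ∑[ c < n ] 𝟙 (does (P? (a , b , c)))
  length-filter-triples {n} P? =
    trans (length-filter-concatMap P? row) (sum-cong-≗ λ a →
    trans (length-filter-concatMap P? (column a)) (sum-cong-≗ λ b →
    length-filter-map P? (λ c → (a , b , c))))
    where
    column : Fin n → Fin n → List (Fin n × Fin n × Fin n)
    column a b = map (λ c → (a , b , c)) (allFin n)
    row : Fin n → List (Fin n × Fin n × Fin n)
    row a = concatMap (column a) (allFin n)

  Nind-DP3-∑ : ∀ {n} (E : Digraph n) → Nind-DP3 E ≡ ∑[ a < n ] ∑[ b < n ] ∑[ c < n ] 𝟙 (isInducedDP3 E a b c)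
  Nind-DP3-∑ {n} E = length-filter-triples {n} _

module UpperBound where

  open TopologicalOrder using (TopologicalNumbering)
  open Counting using (𝟙; Nind-DP3-∑; ∧-intro; ∧-elimˡ; ∧-elimʳ; neq-refl; neq-true)
  open import Data.Bool using (Bool; true; false; T; not; _∧_; _∨_; _xor_; if_then_else_)
  open import Data.Empty using (⊥-elim)
  open import Data.Fin using (Fin; zero; suc; _≟_)
  open import Data.Integer using (ℤ; +_; -[1+_]; +≤+; 0ℤ; 1ℤ; -1ℤ; _+_; _*_; _≤_; _≤ᵇ_)
  open import Data.Integer.Properties
    using (≤-refl; +-mono-≤; +-monoˡ-≤; *-monoˡ-≤-nonNeg; ≤ᵇ⇒≤; pos-+; pos-*; drop‿+≤+; *-zeroˡ; +-*-semiring; module ≤-Reasoning)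
  open import Data.Integer.Tactic.RingSolver using (solve-∀)
  import Data.Nat as ℕ
  import Data.Nat.Properties as ℕ
  import Algebra.Properties.Semiring.Sum ℕ.+-*-semiring as ℕΣ
  open import Data.Nat using (ℕ; zero; suc; _<ᵇ_)
  open import Data.Vec using (Vec; []; _∷_)
  open import Function using (_∘_)
  open import Relation.Binary.Definitions using (tri<; tri≈; tri>)
  open import Relation.Binary.PropositionalEquality
  open import Relation.Nullary using (Dec; yes; no)
  open import Algebra.Properties.Semiring.Sum +-*-semiring
    using (sum; sum-syntax; sum-cong-≗; ∑-distrib-+; ∑-comm; *-distribˡ-sum; *-distribʳ-sum)

  allBool : ∀ k → (Vec Bool k → Bool) → Bool
  allBool zero    f = f []
  allBool (suc k) f = allBool k (λ bs → f (true ∷ bs)) ∧ allBool k (λ bs → f (false ∷ bs))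

  allBool-sound : ∀ k (f : Vec Bool k → Bool) → T (allBool k f) → ∀ bs → T (f bs)
  allBool-sound zero    f holds []           = holds
  allBool-sound (suc k) f holds (true  ∷ bs) = allBool-sound k _ (∧-elimˡ holds) bs
  allBool-sound (suc k) f holds (false ∷ bs) = allBool-sound k _ (∧-elimʳ holds) bs

  sum-mono-≤ : ∀ {m} {f g : Fin m → ℤ} → (∀ i → f i ≤ g i) → sum f ≤ sum g
  sum-mono-≤ {zero}  f≤g = ≤-refl
  sum-mono-≤ {suc m} f≤g = +-mono-≤ (f≤g zero) (sum-mono-≤ (f≤g ∘ suc))

  sum-nonneg : ∀ {m} {f : Fin m → ℤ} → (∀ i → 0ℤ ≤ f i) → 0ℤ ≤ sum f
  sum-nonneg {zero}  f≥0 = ≤-refl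
  sum-nonneg {suc m} f≥0 = +-mono-≤ (f≥0 zero) (sum-nonneg (f≥0 ∘ suc))

  sum-const : ∀ m c → ∑[ i < m ] c ≡ + m * c
  sum-const zero    c = sym (*-zeroˡ c)
  sum-const (suc m) c = trans (cong (λ s → c + s) (sum-const m c)) (shift (+ m) c)
    where
    shift : ∀ k c → c + k * c ≡ (1ℤ + k) * c
    shift = solve-∀

  +-sum : ∀ {m} (f : Fin m → ℕ) → + (ℕΣ.sum f) ≡ ∑[ i < m ] (+ f i)
  +-sum {zero}  f = refl
  +-sum {suc m} f = trans (pos-+ (f zero) _) (cong (λ s → + f zero + s) (+-sum (f ∘ suc)))

  module TripleSums (n : ℕ) where

    ∑³ : (Fin n → Fin n → Fin n → ℤ) → ℤ
    ∑³ F = ∑[ x < n ] ∑[ y < n ] ∑[ z < n ] F x y z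

    ∑³-mono-≤ : ∀ {F G} → (∀ x y z → F x y z ≤ G x y z) → ∑³ F ≤ ∑³ G
    ∑³-mono-≤ F≤G = sum-mono-≤ λ x → sum-mono-≤ λ y → sum-mono-≤ λ z → F≤G x y z

    ∑³-distrib-+ : ∀ F G → ∑³ (λ x y z → F x y z + G x y z) ≡ ∑³ F + ∑³ G
    ∑³-distrib-+ F G =
      trans (sum-cong-≗ λ x →
               trans (sum-cong-≗ λ y → ∑-distrib-+ (F x y) (G x y))
                     (∑-distrib-+ (λ y → ∑[ z < n ] F x y z) (λ y → ∑[ z < n ] G x y z)))
            (∑-distrib-+ (λ x → ∑[ y < n ] ∑[ z < n ] F x y z) (λ x → ∑[ y < n ] ∑[ z < n ] G x y z))

    ∑³-*ˡ : ∀ c F → ∑³ (λ x y z → c * F x y z) ≡ c * ∑³ F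
    ∑³-*ˡ c F = sym (trans (*-distribˡ-sum c (λ x → ∑[ y < n ] ∑[ z < n ] F x y z)) (sum-cong-≗ λ x →
                  trans (*-distribˡ-sum c (λ y → ∑[ z < n ] F x y z)) (sum-cong-≗ λ y → *-distribˡ-sum c (F x y))))

    ∑³-one : ∑³ (λ _ _ _ → 1ℤ) ≡ + (n ℕ.* (n ℕ.* n))
    ∑³-one = begin
      ∑³ (λ _ _ _ → 1ℤ)                  ≡⟨ sum-cong-≗ {n} (λ _ → trans (sum-cong-≗ {n} λ _ → sum-const n 1ℤ)
                                                                          (sum-const n (+ n * 1ℤ))) ⟩
      ∑[ x < n ] (+ n * (+ n * 1ℤ))      ≡⟨ sum-const n _ ⟩
      + n * (+ n * (+ n * 1ℤ))           ≡⟨ cong (λ m → + n * (+ n * m)) (sym (pos-* n 1)) ⟩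
      + n * (+ n * + (n ℕ.* 1))          ≡⟨ cong (+ n *_) (sym (pos-* n (n ℕ.* 1))) ⟩
      + n * + (n ℕ.* (n ℕ.* 1))          ≡⟨ sym (pos-* n (n ℕ.* (n ℕ.* 1))) ⟩
      + (n ℕ.* (n ℕ.* (n ℕ.* 1)))        ≡⟨ cong (λ m → + (n ℕ.* m)) (cong (n ℕ.*_) (ℕ.*-identityʳ n)) ⟩
      + (n ℕ.* (n ℕ.* n))                ∎
      where open ≡-Reasoning

    ∑³-swap₁₂ : ∀ F → ∑³ (λ x y z → F y x z) ≡ ∑³ F
    ∑³-swap₁₂ F = ∑-comm (λ x y → ∑[ z < n ] F y x z)

    ∑³-swap₂₃ : ∀ F → ∑³ (λ x y z → F x z y) ≡ ∑³ F
    ∑³-swap₂₃ F = sum-cong-≗ λ x → ∑-comm (λ y z → F x z y)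

    ∑³-rotate : ∀ F → ∑³ (λ x y z → F y z x) ≡ ∑³ F
    ∑³-rotate F = trans (∑³-swap₁₂ (λ x y z → F x z y)) (∑³-swap₂₃ F)

    ∑³-rotations : ∀ F → ∑³ (λ x y z → F x y z + F y z x + F z x y) ≡ + 3 * ∑³ F
    ∑³-rotations F = begin
      ∑³ (λ x y z → F x y z + F y z x + F z x y)
        ≡⟨ ∑³-distrib-+ _ _ ⟩
      ∑³ (λ x y z → F x y z + F y z x) + ∑³ (λ x y z → F z x y)
        ≡⟨ cong₂ _+_ (∑³-distrib-+ _ _) (trans (∑³-rotate (λ x y z → F y z x)) (∑³-rotate F)) ⟩
      ∑³ F + ∑³ (λ x y z → F y z x) + ∑³ F
        ≡⟨ cong (λ s → ∑³ F + s + ∑³ F) (∑³-rotate F) ⟩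
      ∑³ F + ∑³ F + ∑³ F
        ≡⟨ thrice (∑³ F) ⟩
      + 3 * ∑³ F ∎
      where
      open ≡-Reasoning
      thrice : ∀ s → s + s + s ≡ + 3 * s
      thrice = solve-∀

    ∑³-permutations : ∀ F →
      ∑³ (λ x y z → F x y z + F x z y + F y x z + F y z x + F z x y + F z y x) ≡ + 6 * ∑³ F
    ∑³-permutations F = begin
      ∑³ (λ x y z → F x y z + F x z y + F y x z + F y z x + F z x y + F z y x)
        ≡⟨ ∑³-distrib-+ _ _ ⟩
      ∑³ (λ x y z → F x y z + F x z y + F y x z + F y z x + F z x y) + ∑³ (λ x y z → F z y x)
        ≡⟨ cong₂ _+_ (∑³-distrib-+ _ _) (trans (∑³-swap₂₃ (λ x y z → F y z x)) (∑³-rotate F)) ⟩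
      ∑³ (λ x y z → F x y z + F x z y + F y x z + F y z x) + ∑³ (λ x y z → F z x y) + ∑³ F
        ≡⟨ cong₂ (λ a b → a + b + ∑³ F) (∑³-distrib-+ _ _) (trans (∑³-rotate (λ x y z → F y z x)) (∑³-rotate F)) ⟩
      ∑³ (λ x y z → F x y z + F x z y + F y x z) + ∑³ (λ x y z → F y z x) + ∑³ F + ∑³ F
        ≡⟨ cong₂ (λ a b → a + b + ∑³ F + ∑³ F) (∑³-distrib-+ _ _) (∑³-rotate F) ⟩
      ∑³ (λ x y z → F x y z + F x z y) + ∑³ (λ x y z → F y x z) + ∑³ F + ∑³ F + ∑³ F
        ≡⟨ cong₂ (λ a b → a + b + ∑³ F + ∑³ F + ∑³ F) (∑³-distrib-+ _ _) (∑³-swap₁₂ F) ⟩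
      ∑³ F + ∑³ (λ x y z → F x z y) + ∑³ F + ∑³ F + ∑³ F + ∑³ F
        ≡⟨ cong (λ a → ∑³ F + a + ∑³ F + ∑³ F + ∑³ F + ∑³ F) (∑³-swap₂₃ F) ⟩
      ∑³ F + ∑³ F + ∑³ F + ∑³ F + ∑³ F + ∑³ F
        ≡⟨ sixfold (∑³ F) ⟩
      + 6 * ∑³ F ∎
      where
      open ≡-Reasoning
      sixfold : ∀ s → s + s + s + s + s + s ≡ + 6 * s
      sixfold = solve-∀

  ±1 : Bool → ℤ
  ±1 true  = 1ℤ
  ±1 false = -1ℤ

  weight : (distinct before adjacent : Bool) → ℤ
  weight distinct before adjacent = if distinct then ±1 (not (before xor adjacent)) else 0ℤ

  -- localValue below, written in the eighteen Booleans it depends on: for the i-th and j-th of the three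
  -- points, dᵢⱼ is their neq, bᵢⱼ says whether i comes before j, and eᵢⱼ whether there is an arc i → j.
  -- localValue unfolds to this definitionally, so the exhaustive checks below apply to it.
  tripleValue : (d₁₂ d₂₁ d₂₃ d₃₂ d₁₃ d₃₁ b₁₂ b₂₁ b₂₃ b₃₂ b₁₃ b₃₁ e₁₂ e₂₁ e₂₃ e₃₂ e₁₃ e₃₁ : Bool) → ℤ
  tripleValue d₁₂ d₂₁ d₂₃ d₃₂ d₁₃ d₃₁ b₁₂ b₂₁ b₂₃ b₃₂ b₁₃ b₃₁ e₁₂ e₂₁ e₂₃ e₃₂ e₁₃ e₃₁ =
    w₂₁ * w₂₃ + w₃₂ * w₃₁ + w₁₃ * w₁₂ +
    + 4 * (p d₁₂ d₂₃ d₁₃ e₁₂ e₂₃ e₂₁ e₃₂ e₁₃ e₃₁ + p d₁₃ d₃₂ d₁₂ e₁₃ e₃₂ e₃₁ e₂₃ e₁₂ e₂₁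
         + p d₂₁ d₁₃ d₂₃ e₂₁ e₁₃ e₁₂ e₃₁ e₂₃ e₃₂ + p d₂₃ d₃₁ d₂₁ e₂₃ e₃₁ e₃₂ e₁₃ e₂₁ e₁₂
         + p d₃₁ d₁₂ d₃₂ e₃₁ e₁₂ e₁₃ e₂₁ e₃₂ e₂₃ + p d₃₂ d₂₁ d₃₁ e₃₂ e₂₁ e₂₃ e₁₂ e₃₁ e₁₃)
    where
    w₂₁ = weight d₁₂ b₁₂ (e₁₂ ∨ e₂₁)
    w₂₃ = weight d₃₂ b₃₂ (e₃₂ ∨ e₂₃)
    w₃₂ = weight d₂₃ b₂₃ (e₂₃ ∨ e₃₂)
    w₃₁ = weight d₁₃ b₁₃ (e₁₃ ∨ e₃₁)
    w₁₃ = weight d₃₁ b₃₁ (e₃₁ ∨ e₁₃)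
    w₁₂ = weight d₂₁ b₂₁ (e₂₁ ∨ e₁₂)
    p : Bool → Bool → Bool → Bool → Bool → Bool → Bool → Bool → Bool → ℤ
    p d₁ d₂ d₃ a₁ a₂ a₃ a₄ a₅ a₆ = + 𝟙 (d₁ ∧ d₂ ∧ d₃ ∧ a₁ ∧ a₂ ∧ not a₃ ∧ not a₄ ∧ not a₅ ∧ not a₆)

  infixr 4 _⇒ᵇ_

  _⇒ᵇ_ : Bool → Bool → Bool
  a ⇒ᵇ b = not a ∨ b

  ⇒ᵇ-intro : ∀ {a b} → (T a → T b) → T (a ⇒ᵇ b)
  ⇒ᵇ-intro {true}  a⇒b = a⇒b _
  ⇒ᵇ-intro {false} a⇒b = _

  ⇒ᵇ-elim : ∀ {a b} → T (a ⇒ᵇ b) → T a → T b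
  ⇒ᵇ-elim {true} holds _ = holds

  coincident-check : Vec Bool 8 → Bool
  coincident-check (d₁₃ ∷ d₃₁ ∷ b₁₁ ∷ b₁₃ ∷ b₃₁ ∷ e₁₁ ∷ e₁₃ ∷ e₃₁ ∷ []) =
    tripleValue false false d₁₃ d₃₁ d₁₃ d₃₁ b₁₁ b₁₁ b₁₃ b₃₁ b₁₃ b₃₁ e₁₁ e₁₁ e₁₃ e₃₁ e₁₃ e₃₁ ≤ᵇ 1ℤ

  coincident-bound : ∀ {d₁₁} d₁₃ d₃₁ b₁₁ b₁₃ b₃₁ e₁₁ e₁₃ e₃₁ → d₁₁ ≡ false →
    tripleValue d₁₁ d₁₁ d₁₃ d₃₁ d₁₃ d₃₁ b₁₁ b₁₁ b₁₃ b₃₁ b₁₃ b₃₁ e₁₁ e₁₁ e₁₃ e₃₁ e₁₃ e₃₁ ≤ 1ℤ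
  coincident-bound d₁₃ d₃₁ b₁₁ b₁₃ b₃₁ e₁₁ e₁₃ e₃₁ refl =
    ≤ᵇ⇒≤ (allBool-sound 8 coincident-check _ (d₁₃ ∷ d₃₁ ∷ b₁₁ ∷ b₁₃ ∷ b₃₁ ∷ e₁₁ ∷ e₁₃ ∷ e₃₁ ∷ []))

  distinct-check : Vec Bool 9 → Bool
  distinct-check (b₁₂ ∷ b₂₃ ∷ b₁₃ ∷ e₁₂ ∷ e₂₁ ∷ e₂₃ ∷ e₃₂ ∷ e₁₃ ∷ e₃₁ ∷ []) =
    ((b₁₂ ∧ b₂₃ ⇒ᵇ b₁₃) ∧ (not b₂₃ ∧ not b₁₂ ⇒ᵇ not b₁₃) ∧
     (e₁₂ ⇒ᵇ b₁₂) ∧ (e₂₁ ⇒ᵇ not b₁₂) ∧ (e₂₃ ⇒ᵇ b₂₃) ∧ (e₃₂ ⇒ᵇ not b₂₃) ∧ (e₁₃ ⇒ᵇ b₁₃) ∧ (e₃₁ ⇒ᵇ not b₁₃))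
    ⇒ᵇ (tripleValue true true true true true true b₁₂ (not b₁₂) b₂₃ (not b₂₃) b₁₃ (not b₁₃)
                    e₁₂ e₂₁ e₂₃ e₃₂ e₁₃ e₃₁ ≤ᵇ 1ℤ)

  distinct-bound :
    ∀ {d₁₂ d₂₁ d₂₃ d₃₂ d₁₃ d₃₁ b₁₂ b₂₁ b₂₃ b₃₂ b₁₃ b₃₁ e₁₂ e₂₁ e₂₃ e₃₂ e₁₃ e₃₁} →
    d₁₂ ≡ true → d₂₁ ≡ true → d₂₃ ≡ true → d₃₂ ≡ true → d₁₃ ≡ true → d₃₁ ≡ true →
    b₂₁ ≡ not b₁₂ → b₃₂ ≡ not b₂₃ → b₃₁ ≡ not b₁₃ →
    (T b₁₂ → T b₂₃ → T b₁₃) → (T b₃₂ → T b₂₁ → T b₃₁) →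
    (T e₁₂ → T b₁₂) → (T e₂₁ → T b₂₁) → (T e₂₃ → T b₂₃) →
    (T e₃₂ → T b₃₂) → (T e₁₃ → T b₁₃) → (T e₃₁ → T b₃₁) →
    tripleValue d₁₂ d₂₁ d₂₃ d₃₂ d₁₃ d₃₁ b₁₂ b₂₁ b₂₃ b₃₂ b₁₃ b₃₁ e₁₂ e₂₁ e₂₃ e₃₂ e₁₃ e₃₁ ≤ 1ℤ
  distinct-bound {b₁₂ = b₁₂} {b₂₃ = b₂₃} {b₁₃ = b₁₃}
                 {e₁₂ = e₁₂} {e₂₁ = e₂₁} {e₂₃ = e₂₃} {e₃₂ = e₃₂} {e₁₃ = e₁₃} {e₃₁ = e₃₁}
                 refl refl refl refl refl refl refl refl refl trans₁ trans₂ f₁₂ f₂₁ f₂₃ f₃₂ f₁₃ f₃₁ =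
    ≤ᵇ⇒≤ (⇒ᵇ-elim (allBool-sound 9 distinct-check _ (b₁₂ ∷ b₂₃ ∷ b₁₃ ∷ e₁₂ ∷ e₂₁ ∷ e₂₃ ∷ e₃₂ ∷ e₁₃ ∷ e₃₁ ∷ []))
      (∧-intro (⇒ᵇ-intro (uncurryᵀ trans₁)) (∧-intro (⇒ᵇ-intro (uncurryᵀ trans₂))
      (∧-intro (⇒ᵇ-intro f₁₂) (∧-intro (⇒ᵇ-intro f₂₁) (∧-intro (⇒ᵇ-intro f₂₃) (∧-intro (⇒ᵇ-intro f₃₂)
      (∧-intro (⇒ᵇ-intro f₁₃) (⇒ᵇ-intro f₃₁)))))))))
    where
    uncurryᵀ : ∀ {a b c} → (T a → T b → T c) → T (a ∧ b) → T c
    uncurryᵀ f p = f (∧-elimˡ p) (∧-elimʳ p)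

  <ᵇ-flip : ∀ {m n} → m ≢ n → (n <ᵇ m) ≡ not (m <ᵇ n)
  <ᵇ-flip {m} {n} m≢n with m <ᵇ n in m<ᵇn | n <ᵇ m in n<ᵇm
  ... | true  | true  =
    ⊥-elim (ℕ.<-asym (ℕ.<ᵇ⇒< m n (subst T (sym m<ᵇn) _)) (ℕ.<ᵇ⇒< n m (subst T (sym n<ᵇm) _)))
  ... | true  | false = refl
  ... | false | true  = refl
  ... | false | false with ℕ.<-cmp m n
  ...   | tri< m<n _ _ = ⊥-elim (subst T m<ᵇn (ℕ.<⇒<ᵇ m<n))
  ...   | tri≈ _ m≡n _ = ⊥-elim (m≢n m≡n)
  ...   | tri> _ _ n<m = ⊥-elim (subst T n<ᵇm (ℕ.<⇒<ᵇ n<m))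

  square-nonneg : ∀ i → 0ℤ ≤ i * i
  square-nonneg (+ zero)    = +≤+ ℕ.z≤n
  square-nonneg (+ suc m)   = +≤+ ℕ.z≤n
  square-nonneg -[1+ m ]    = +≤+ ℕ.z≤n

  module _ {n : ℕ} (E : Digraph n) (numbering : TopologicalNumbering E) where

    open TopologicalNumbering numbering
    open TripleSums n

    before : Fin n → Fin n → Bool
    before u v = number u <ᵇ number v

    before-flip : ∀ {u v} → u ≢ v → before v u ≡ not (before u v)
    before-flip u≢v = <ᵇ-flip (u≢v ∘ injective)

    before-trans : ∀ {u v w} → T (before u v) → T (before v w) → T (before u w)
    before-trans {u} {v} {w} p q =
      ℕ.<⇒<ᵇ (ℕ.<-trans (ℕ.<ᵇ⇒< (number u) (number v) p) (ℕ.<ᵇ⇒< (number v) (number w) q))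

    arc-before : ∀ {u v} → T (E u v) → T (before u v)
    arc-before e = ℕ.<⇒<ᵇ (increasing e)

    τ : Fin n → Fin n → ℤ
    τ y x = weight (neq x y) (before x y) (E x y ∨ E y x)

    δ : Fin n → Fin n → Fin n → ℤ
    δ x y z = + 𝟙 (isInducedDP3 E x y z)

    localValue : Fin n → Fin n → Fin n → ℤ
    localValue x y z = τ y x * τ y z + τ z y * τ z x + τ x z * τ x y
                     + + 4 * (δ x y z + δ x z y + δ y x z + δ y z x + δ z x y + δ z y x)

    localValue-rotate : ∀ x y z → localValue y z x ≡ localValue x y z
    localValue-rotate x y z =
      rotate (τ y x) (τ y z) (τ z y) (τ z x) (τ x z) (τ x y)
             (δ x y z) (δ x z y) (δ y x z) (δ y z x) (δ z x y) (δ z y x)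
      where
      rotate : ∀ a b c d e f p q r s t u →
        c * d + e * f + a * b + + 4 * (s + r + u + t + p + q) ≡ a * b + c * d + e * f + + 4 * (p + q + r + s + t + u)
      rotate = solve-∀

    coincident : ∀ x z → localValue x x z ≤ 1ℤ
    coincident x z = coincident-bound (neq x z) (neq z x) (before x x) (before x z) (before z x)
                                      (E x x) (E x z) (E z x) (neq-refl x)

    localValue≤1 : ∀ x y z → localValue x y z ≤ 1ℤ
    localValue≤1 x y z = by-cases x y z (x ≟ y) (y ≟ z) (x ≟ z)
      where
      by-cases : ∀ x y z → Dec (x ≡ y) → Dec (y ≡ z) → Dec (x ≡ z) → localValue x y z ≤ 1ℤ
      by-cases x _ z (yes refl) _          _          = coincident x z
      by-cases x y _ (no _)     (yes refl) _          =
        subst (_≤ 1ℤ) (sym (trans (localValue-rotate y x y) (localValue-rotate y y x))) (coincident y x)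
      by-cases x y _ (no _)     (no _)     (yes refl) = subst (_≤ 1ℤ) (sym (localValue-rotate x x y)) (coincident x y)
      by-cases x y z (no x≢y)   (no y≢z)   (no x≢z)   =
        distinct-bound (neq-true x≢y) (neq-true (x≢y ∘ sym)) (neq-true y≢z) (neq-true (y≢z ∘ sym))
                       (neq-true x≢z) (neq-true (x≢z ∘ sym))
                       (before-flip x≢y) (before-flip y≢z) (before-flip x≢z) before-trans before-trans
                       arc-before arc-before arc-before arc-before arc-before arc-before

    squares : ℤ
    squares = ∑³ λ x y z → τ y x * τ y z

    squares-nonneg : 0ℤ ≤ squares
    squares-nonneg = subst (0ℤ ≤_) (trans (sym column-squares) (sym (∑³-swap₁₂ (λ x y z → τ x y * τ x z))))
                           (sum-nonneg λ x → square-nonneg (∑[ y < n ] τ x y))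
      where
      column-squares : ∑³ (λ x y z → τ x y * τ x z) ≡ ∑[ x < n ] ((∑[ y < n ] τ x y) * (∑[ z < n ] τ x z))
      column-squares = sum-cong-≗ λ x → trans (sum-cong-≗ λ y → sym (*-distribˡ-sum (τ x y) (τ x)))
                                               (sym (*-distribʳ-sum (∑[ z < n ] τ x z) (τ x)))

    ∑³-δ : ∑³ δ ≡ + Nind-DP3 E
    ∑³-δ = sym (trans (cong +_ (Nind-DP3-∑ E)) (trans (+-sum {n} _) (sum-cong-≗ {n} λ a →
                  trans (+-sum {n} _) (sum-cong-≗ {n} λ b → +-sum {n} _))))

    ∑³-localValue : ∑³ localValue ≡ + 3 * squares + + 4 * (+ 6 * + Nind-DP3 E)
    ∑³-localValue = begin
      ∑³ localValue
        ≡⟨ ∑³-distrib-+ _ _ ⟩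
      ∑³ (λ x y z → τ y x * τ y z + τ z y * τ z x + τ x z * τ x y)
        + ∑³ (λ x y z → + 4 * (δ x y z + δ x z y + δ y x z + δ y z x + δ z x y + δ z y x))
        ≡⟨ cong₂ _+_ (∑³-rotations (λ x y z → τ y x * τ y z)) (∑³-*ˡ (+ 4) _) ⟩
      + 3 * squares + + 4 * ∑³ (λ x y z → δ x y z + δ x z y + δ y x z + δ y z x + δ z x y + δ z y x)
        ≡⟨ cong (λ s → + 3 * squares + + 4 * s) (trans (∑³-permutations δ) (cong (+ 6 *_) ∑³-δ)) ⟩
      + 3 * squares + + 4 * (+ 6 * + Nind-DP3 E) ∎
      where open ≡-Reasoning

    24*Nind≤n³ : 24 ℕ.* Nind-DP3 E ℕ.≤ n ℕ.* (n ℕ.* n)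
    24*Nind≤n³ = drop‿+≤+ (begin
      + (24 ℕ.* Nind-DP3 E)                         ≡⟨ scale (Nind-DP3 E) ⟩
      0ℤ + + 4 * (+ 6 * + Nind-DP3 E)               ≤⟨ +-monoˡ-≤ _ (*-monoˡ-≤-nonNeg (+ 3) squares-nonneg) ⟩
      + 3 * squares + + 4 * (+ 6 * + Nind-DP3 E)    ≡⟨ sym ∑³-localValue ⟩
      ∑³ localValue                                 ≤⟨ ∑³-mono-≤ localValue≤1 ⟩
      ∑³ (λ _ _ _ → 1ℤ)                             ≡⟨ ∑³-one ⟩
      + (n ℕ.* (n ℕ.* n))                           ∎)
      where
      open ≤-Reasoning
      regroup : ∀ k → + 24 * k ≡ 0ℤ + + 4 * (+ 6 * k)
      regroup = solve-∀
      scale : ∀ m → + (24 ℕ.* m) ≡ 0ℤ + + 4 * (+ 6 * + m)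
      scale m = trans (pos-* 24 m) (regroup (+ m))

module LowerBound where

  open Counting using (𝟙; Nind-DP3-∑; ∧-elimˡ; ∧-elimʳ; isInducedDP3-intro)
  open import Data.Bool using (Bool; true; false; T; not; _∧_; _xor_)
  open import Data.Bool.Properties using (not-involutive; T-≡; not-distribˡ-xor)
  open import Data.Empty using (⊥-elim)
  open import Data.Fin using (Fin; zero; suc; toℕ)
  open import Data.Nat using (ℕ; zero; suc; _+_; _*_; _∸_; _≤_; _<_; _<ᵇ_; z≤n; s≤s; z<s; s<s)
  open import Data.Nat.Combinatorics using (_C_; nC1≡n; nCk+nC[k+1]≡[n+1]C[k+1])
  open import Data.Nat.Properties
  open import Data.Nat.Tactic.RingSolver using (solve-∀)
  open import Function using (_∘_; Equivalence)
  open import Relation.Binary.PropositionalEquality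
  open import Relation.Nullary using (¬_)
  open import Algebra.Properties.Semiring.Sum +-*-semiring
    using (sum; sum-syntax; sum-cong-≗; ∑-comm; ∑-distrib-+; *-distribˡ-sum; *-distribʳ-sum)

  𝟙-*-≤ : ∀ {x y z} → (T x → T y → T z) → 𝟙 x * 𝟙 y ≤ 𝟙 z
  𝟙-*-≤ {true}  {true}  {true}  _   = ≤-refl
  𝟙-*-≤ {true}  {true}  {false} x∧y = ⊥-elim (x∧y _ _)
  𝟙-*-≤ {true}  {false}         _   = z≤n
  𝟙-*-≤ {false}                 _   = z≤n

  sum-mono-≤ : ∀ {m} {f g : Fin m → ℕ} → (∀ i → f i ≤ g i) → sum f ≤ sum g
  sum-mono-≤ {zero}  f≤g = z≤n
  sum-mono-≤ {suc m} f≤g = +-mono-≤ (f≤g zero) (sum-mono-≤ (f≤g ∘ suc))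

  ∑< : ℕ → (ℕ → ℕ) → ℕ
  ∑< m g = ∑[ i < m ] g (toℕ i)

  ∑<-cong : ∀ m {g h} → (∀ a → a < m → g a ≡ h a) → ∑< m g ≡ ∑< m h
  ∑<-cong zero    g≡h = refl
  ∑<-cong (suc m) g≡h = cong₂ _+_ (g≡h 0 z<s) (∑<-cong m (λ a a<m → g≡h (suc a) (s<s a<m)))

  ∑<-mono-≤ : ∀ m {g h} → (∀ a → a < m → g a ≤ h a) → ∑< m g ≤ ∑< m h
  ∑<-mono-≤ zero    g≤h = z≤n
  ∑<-mono-≤ (suc m) g≤h = +-mono-≤ (g≤h 0 z<s) (∑<-mono-≤ m (λ a a<m → g≤h (suc a) (s<s a<m)))

  ∑<-last : ∀ m g → ∑< (suc m) g ≡ ∑< m g + g m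
  ∑<-last zero    g = +-comm (g 0) 0
  ∑<-last (suc m) g = trans (cong (g 0 +_) (∑<-last m (g ∘ suc))) (sym (+-assoc (g 0) _ _))

  ∑<-split : ∀ m k g → ∑< (m + k) g ≡ ∑< m g + ∑< k (λ j → g (m + j))
  ∑<-split zero    k g = refl
  ∑<-split (suc m) k g = trans (cong (g 0 +_) (∑<-split m k (g ∘ suc))) (sym (+-assoc (g 0) _ _))

  ∑<-prefix-≤ : ∀ {m n} g → m ≤ n → ∑< m g ≤ ∑< n g
  ∑<-prefix-≤ {m} {n} g m≤n = begin
    ∑< m g                                          ≤⟨ m≤m+n (∑< m g) _ ⟩
    ∑< m g + ∑< (n ∸ m) (λ j → g (m + j))         ≡⟨ ∑<-split m (n ∸ m) g ⟨
    ∑< (m + (n ∸ m)) g                              ≡⟨ cong (λ k → ∑< k g) (m+[n∸m]≡n m≤n) ⟩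
    ∑< n g                                          ∎
    where open ≤-Reasoning

  ∑<-suffix-≤ : ∀ {m n} g → m ≤ n → ∑< (n ∸ m) (λ j → g (m + j)) ≤ ∑< n g
  ∑<-suffix-≤ {m} {n} g m≤n = begin
    ∑< (n ∸ m) (λ j → g (m + j))                   ≤⟨ m≤n+m _ (∑< m g) ⟩
    ∑< m g + ∑< (n ∸ m) (λ j → g (m + j))         ≡⟨ ∑<-split m (n ∸ m) g ⟨
    ∑< (m + (n ∸ m)) g                              ≡⟨ cong (λ k → ∑< k g) (m+[n∸m]≡n m≤n) ⟩
    ∑< n g                                          ∎
    where open ≤-Reasoning

  isEven : ℕ → Bool
  isEven zero    = true
  isEven (suc k) = not (isEven k)

  𝟙-not : ∀ b → 𝟙 b + 𝟙 (not b) ≡ 1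
  𝟙-not true  = refl
  𝟙-not false = refl

  ∑<-alternating : ∀ (p : ℕ → Bool) → (∀ a → p (suc a) ≡ not (p a)) →
    ∀ k → ∑< (suc (suc k)) (𝟙 ∘ p) ≡ ∑< k (𝟙 ∘ p) + 1
  ∑<-alternating p alt k = begin
    ∑< (suc (suc k)) (𝟙 ∘ p)                   ≡⟨ ∑<-last (suc k) (𝟙 ∘ p) ⟩
    ∑< (suc k) (𝟙 ∘ p) + 𝟙 (p (suc k))         ≡⟨ cong (_+ 𝟙 (p (suc k))) (∑<-last k (𝟙 ∘ p)) ⟩
    ∑< k (𝟙 ∘ p) + 𝟙 (p k) + 𝟙 (p (suc k))     ≡⟨ +-assoc (∑< k (𝟙 ∘ p)) _ _ ⟩
    ∑< k (𝟙 ∘ p) + (𝟙 (p k) + 𝟙 (p (suc k)))   ≡⟨ cong (λ b → ∑< k (𝟙 ∘ p) + (𝟙 (p k) + 𝟙 b)) (alt k) ⟩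
    ∑< k (𝟙 ∘ p) + (𝟙 (p k) + 𝟙 (not (p k)))   ≡⟨ cong (∑< k (𝟙 ∘ p) +_) (𝟙-not (p k)) ⟩
    ∑< k (𝟙 ∘ p) + 1                           ∎
    where open ≡-Reasoning

  half-≤-step : ∀ (p : ℕ → Bool) → (∀ a → p (suc a) ≡ not (p a)) →
    ∀ k → k ≤ 2 * ∑< k (𝟙 ∘ p) → suc (suc k) ≤ 2 * ∑< (suc (suc k)) (𝟙 ∘ p)
  half-≤-step p alt k k≤ = begin
    suc (suc k)                          ≤⟨ s≤s (s≤s k≤) ⟩
    suc (suc (2 * ∑< k (𝟙 ∘ p)))         ≡⟨ double-suc (∑< k (𝟙 ∘ p)) ⟩
    2 * (∑< k (𝟙 ∘ p) + 1)               ≡⟨ cong (2 *_) (∑<-alternating p alt k) ⟨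
    2 * ∑< (suc (suc k)) (𝟙 ∘ p)         ∎
    where
    open ≤-Reasoning
    double-suc : ∀ s → suc (suc (2 * s)) ≡ 2 * (s + 1)
    double-suc = solve-∀

  evens-below : ∀ k → k ≤ 2 * ∑< k (𝟙 ∘ isEven)
  evens-below zero          = z≤n
  evens-below (suc zero)    = s≤s z≤n
  evens-below (suc (suc k)) = half-≤-step isEven (λ _ → refl) k (evens-below k)

  not-xor : ∀ a c → not a xor c ≡ not (a xor c)
  not-xor a c = sym (not-distribˡ-xor a c)

  opposite-parity-below : ∀ k → k ≤ 2 * ∑< k (λ a → 𝟙 (isEven a xor isEven k))
  opposite-parity-below zero          = z≤n
  opposite-parity-below (suc zero)    = s≤s z≤n
  opposite-parity-below (suc (suc k)) =
    subst (λ e → suc (suc k) ≤ 2 * ∑< (suc (suc k)) (λ a → 𝟙 (isEven a xor e))) (sym (not-involutive (isEven k)))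
      (half-≤-step (λ a → isEven a xor isEven k) (λ a → not-xor (isEven a) (isEven k)) k (opposite-parity-below k))

  parity-after : ∀ B j → isEven B xor isEven (suc B + j) ≡ isEven j
  parity-after zero    j = not-involutive (isEven j)
  parity-after (suc B) j = trans (not-xor-not (isEven B) (isEven (suc B + j))) (parity-after B j)
    where
    not-xor-not : ∀ a b → not a xor not b ≡ a xor b
    not-xor-not true  b = refl
    not-xor-not false b = not-involutive b

  alternating : ∀ {n} → Digraph n
  alternating u v = (toℕ u <ᵇ toℕ v) ∧ (isEven (toℕ u) xor isEven (toℕ v))

  alternating-forward : ∀ {n} {u v : Fin n} → T (alternating u v) → toℕ u < toℕ v
  alternating-forward {u = u} {v} uv = <ᵇ⇒< (toℕ u) (toℕ v) (∧-elimˡ uv)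

  alternating-acyclic : ∀ {n} → IsDAG (alternating {n})
  alternating-acyclic v cycle = <-irrefl refl (forward cycle)
    where
    forward : ∀ {u w} → Walk⁺ alternating u w → toℕ u < toℕ w
    forward (arc uw)     = alternating-forward uw
    forward (uv ∷ʷ walk) = <-trans (alternating-forward uv) (forward walk)

  alternating-induced : ∀ {n} {a b c : Fin n} → T (alternating a b) → T (alternating b c) →
    T (isInducedDP3 alternating a b c)
  alternating-induced {n} {a} {b} {c} ab bc =
    isInducedDP3-intro {E = alternating} {a} {b} {c} (≢ a<b) (≢ b<c) (≢ a<c) ab bc
      (backward a<b) (backward b<c) same-parity (backward a<c)
    where
    a<b = alternating-forward ab
    b<c = alternating-forward bc
    a<c = <-trans a<b b<c
    ≢ : ∀ {u v : Fin n} → toℕ u < toℕ v → u ≢ v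
    ≢ u<v refl = <-irrefl refl u<v
    backward : ∀ {u v : Fin n} → toℕ u < toℕ v → ¬ T (alternating v u)
    backward u<v vu = <-asym u<v (alternating-forward vu)
    parity-clash : ∀ x y z → T (x xor y) → T (y xor z) → ¬ T (x xor z)
    parity-clash true  true  _     ()  _  _
    parity-clash false false _     ()  _  _
    parity-clash true  false false _   () _
    parity-clash false true  true  _   () _
    parity-clash true  false true  _   _  ()
    parity-clash false true  false _   _  ()
    same-parity : ¬ T (alternating a c)
    same-parity ac =
      parity-clash (isEven (toℕ a)) (isEven (toℕ b)) (isEven (toℕ c)) (∧-elimʳ ab) (∧-elimʳ bc) (∧-elimʳ ac)

  ∑<-id≡nC2 : ∀ n → ∑< n (λ B → B) ≡ n C 2
  ∑<-id≡nC2 zero    = refl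
  ∑<-id≡nC2 (suc n) = begin
    ∑< (suc n) (λ B → B)   ≡⟨ ∑<-last n (λ B → B) ⟩
    ∑< n (λ B → B) + n     ≡⟨ cong₂ _+_ (∑<-id≡nC2 n) (sym (nC1≡n n)) ⟩
    n C 2 + n C 1          ≡⟨ +-comm (n C 2) (n C 1) ⟩
    n C 1 + n C 2          ≡⟨ nCk+nC[k+1]≡[n+1]C[k+1] n 1 ⟩
    suc n C 2              ∎
    where open ≡-Reasoning

  -- a 3-subset of {0, …, n-1} with middle element B: B choices below, n - 1 - B above
  ∑<-middle≡nC3 : ∀ n → ∑< n (λ B → B * (n ∸ suc B)) ≡ n C 3
  ∑<-middle≡nC3 zero    = refl
  ∑<-middle≡nC3 (suc n) = begin
    ∑< (suc n) (λ B → B * (n ∸ B))                      ≡⟨ ∑<-last n (λ B → B * (n ∸ B)) ⟩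
    ∑< n (λ B → B * (n ∸ B)) + n * (n ∸ n)              ≡⟨ cong (λ k → ∑< n (λ B → B * (n ∸ B)) + n * k) (n∸n≡0 n) ⟩
    ∑< n (λ B → B * (n ∸ B)) + n * 0                    ≡⟨ cong (∑< n (λ B → B * (n ∸ B)) +_) (*-zeroʳ n) ⟩
    ∑< n (λ B → B * (n ∸ B)) + 0                        ≡⟨ +-identityʳ _ ⟩
    ∑< n (λ B → B * (n ∸ B))                            ≡⟨ ∑<-cong n (λ B B<n → cong (B *_) (+-∸-assoc 1 B<n)) ⟩
    ∑< n (λ B → B * (1 + (n ∸ suc B)))                  ≡⟨ ∑<-cong n (λ B _ → *-suc B (n ∸ suc B)) ⟩
    ∑< n (λ B → B + B * (n ∸ suc B))                    ≡⟨ ∑-distrib-+ {n} (λ b → toℕ b) (λ b → toℕ b * (n ∸ suc (toℕ b))) ⟩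
    ∑< n (λ B → B) + ∑< n (λ B → B * (n ∸ suc B))       ≡⟨ cong₂ _+_ (∑<-id≡nC2 n) (∑<-middle≡nC3 n) ⟩
    n C 2 + n C 3                                       ≡⟨ nCk+nC[k+1]≡[n+1]C[k+1] n 2 ⟩
    suc n C 3                                           ∎
    where open ≡-Reasoning

  <ᵇ-true : ∀ {a b} → a < b → (a <ᵇ b) ≡ true
  <ᵇ-true a<b = Equivalence.to T-≡ (<⇒<ᵇ a<b)

  module _ (n : ℕ) where

    in-degree : ℕ → ℕ
    in-degree B = ∑< n (λ a → 𝟙 ((a <ᵇ B) ∧ (isEven a xor isEven B)))

    out-degree : ℕ → ℕ
    out-degree B = ∑< n (λ c → 𝟙 ((B <ᵇ c) ∧ (isEven B xor isEven c)))

    in-degree-≥ : ∀ {B} → B ≤ n → B ≤ 2 * in-degree B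
    in-degree-≥ {B} B≤n = begin
      B                                             ≤⟨ opposite-parity-below B ⟩
      2 * ∑< B (λ a → 𝟙 (isEven a xor isEven B))    ≡⟨ cong (2 *_) (∑<-cong B below) ⟩
      2 * ∑< B g                                    ≤⟨ *-monoʳ-≤ 2 (∑<-prefix-≤ g B≤n) ⟩
      2 * in-degree B                               ∎
      where
      open ≤-Reasoning
      g : ℕ → ℕ
      g a = 𝟙 ((a <ᵇ B) ∧ (isEven a xor isEven B))
      below : ∀ a → a < B → 𝟙 (isEven a xor isEven B) ≡ g a
      below a a<B = cong (λ t → 𝟙 (t ∧ (isEven a xor isEven B))) (sym (<ᵇ-true a<B))

    out-degree-≥ : ∀ {B} → B < n → n ∸ suc B ≤ 2 * out-degree B
    out-degree-≥ {B} B<n = begin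
      n ∸ suc B                                       ≤⟨ evens-below (n ∸ suc B) ⟩
      2 * ∑< (n ∸ suc B) (𝟙 ∘ isEven)                 ≡⟨ cong (2 *_) (∑<-cong (n ∸ suc B) above) ⟩
      2 * ∑< (n ∸ suc B) (λ j → g (suc B + j))        ≤⟨ *-monoʳ-≤ 2 (∑<-suffix-≤ g B<n) ⟩
      2 * out-degree B                                ∎
      where
      open ≤-Reasoning
      g : ℕ → ℕ
      g c = 𝟙 ((B <ᵇ c) ∧ (isEven B xor isEven c))
      above : ∀ j → j < n ∸ suc B → 𝟙 (isEven j) ≡ g (suc B + j)
      above j _ = sym (cong₂ (λ t e → 𝟙 (t ∧ e)) (<ᵇ-true (s≤s (m≤m+n B j))) (parity-after B j))

    paths-≤-Nind : ∑< n (λ B → in-degree B * out-degree B) ≤ Nind-DP3 (alternating {n})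
    paths-≤-Nind = begin
      ∑[ b < n ] (∑[ a < n ] X a b * ∑[ c < n ] X b c)
        ≡⟨ sum-cong-≗ {n} (λ b → *-distribʳ-sum (∑[ c < n ] X b c) (λ a → X a b)) ⟩
      ∑[ b < n ] ∑[ a < n ] (X a b * ∑[ c < n ] X b c)
        ≡⟨ sum-cong-≗ {n} (λ b → sum-cong-≗ {n} λ a → *-distribˡ-sum (X a b) (X b)) ⟩
      ∑[ b < n ] ∑[ a < n ] ∑[ c < n ] (X a b * X b c)
        ≡⟨ ∑-comm (λ b a → ∑[ c < n ] (X a b * X b c)) ⟩
      ∑[ a < n ] ∑[ b < n ] ∑[ c < n ] (X a b * X b c)
        ≤⟨ sum-mono-≤ (λ a → sum-mono-≤ λ b → sum-mono-≤ λ c → 𝟙-path a b c) ⟩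
      ∑[ a < n ] ∑[ b < n ] ∑[ c < n ] 𝟙 (isInducedDP3 alternating a b c)
        ≡⟨ Nind-DP3-∑ (alternating {n}) ⟨
      Nind-DP3 (alternating {n})
        ∎
      where
      open ≤-Reasoning
      X : Fin n → Fin n → ℕ
      X u v = 𝟙 (alternating u v)
      𝟙-path : ∀ a b c → X a b * X b c ≤ 𝟙 (isInducedDP3 alternating a b c)
      𝟙-path a b c = 𝟙-*-≤ (alternating-induced {n} {a} {b} {c})

    C₃≤4*Nind : n C 3 ≤ 4 * Nind-DP3 (alternating {n})
    C₃≤4*Nind = begin
      n C 3
        ≡⟨ ∑<-middle≡nC3 n ⟨
      ∑< n (λ B → B * (n ∸ suc B))
        ≤⟨ ∑<-mono-≤ n (λ B B<n → *-mono-≤ (in-degree-≥ (<⇒≤ B<n)) (out-degree-≥ B<n)) ⟩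
      ∑< n (λ B → 2 * in-degree B * (2 * out-degree B))
        ≡⟨ ∑<-cong n (λ B _ → regroup (in-degree B) (out-degree B)) ⟩
      ∑< n (λ B → 4 * (in-degree B * out-degree B))
        ≡⟨ *-distribˡ-sum {n} 4 (λ b → in-degree (toℕ b) * out-degree (toℕ b)) ⟨
      4 * ∑< n (λ B → in-degree B * out-degree B)
        ≤⟨ *-monoʳ-≤ 4 paths-≤-Nind ⟩
      4 * Nind-DP3 (alternating {n})
        ∎
      where
      open ≤-Reasoning
      regroup : ∀ l r → 2 * l * (2 * r) ≡ 4 * (l * r)
      regroup = solve-∀

module Asymptotics where

  open import Data.Nat using (ℕ; zero; suc; _+_; _*_; _≤_)
  open import Data.Nat.Properties
  import Data.Nat.Coprimality as Coprimality
  open import Data.Nat.Combinatorics using (_C_; nC1≡n; nCk+nC[k+1]≡[n+1]C[k+1])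
  open import Data.Nat.Tactic.RingSolver using (solve-∀)
  open import Data.Integer as ℤ using (ℤ; +_; -[1+_]; +[1+_]; +≤+; -≤+)
  import Data.Integer.Properties as ℤ
  open import Data.Rational as ℚ using (ℚ; mkℚ)
  import Data.Rational.Properties as ℚ
  open import Data.Rational.Unnormalised as ℚᵘ using (ℚᵘ; mkℚᵘ; *≤*)
  import Data.Rational.Unnormalised.Properties as ℚᵘ
  open import Data.Product using (_,_)
  open import Relation.Binary.PropositionalEquality

  toℚᵘ-ℕ→ℚ : ∀ k → ℚ.toℚᵘ (ℕ→ℚ k) ≡ mkℚᵘ (+ k) 0
  toℚᵘ-ℕ→ℚ k = cong ℚ.toℚᵘ (ℚ.normalize-coprime (Coprimality.sym (Coprimality.1-coprimeTo k)))

  -- Unnormalised, so that numerator and denominator of (1/4 + z/(dm+1))·C compute.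
  quarter+-scaled : ℤ → ℕ → ℕ → ℚᵘ
  quarter+-scaled z dm C = (mkℚᵘ (+ 1) 3 ℚᵘ.+ mkℚᵘ z dm) ℚᵘ.* mkℚᵘ (+ C) 0

  toℚᵘ-quarter+ : ∀ z dm .(c : Coprimality.Coprime ℤ.∣ z ∣ (suc dm)) C →
    ℚ.toℚᵘ ((quarter ℚ.+ mkℚ z dm c) ℚ.* ℕ→ℚ C) ℚᵘ.≃ quarter+-scaled z dm C
  toℚᵘ-quarter+ z dm c C =
    ℚᵘ.≃-trans (ℚ.toℚᵘ-homo-* (quarter ℚ.+ mkℚ z dm c) (ℕ→ℚ C))
      (ℚᵘ.*-cong (ℚ.toℚᵘ-homo-+ quarter (mkℚ z dm c)) (ℚᵘ.≃-reflexive (toℚᵘ-ℕ→ℚ C)))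

  ↥-quarter+-scaled : ∀ p dm C → ℚᵘ.↥ (quarter+-scaled (+ p) dm C) ≡ + ((suc dm + p * 4) * C)
  ↥-quarter+-scaled p dm C = begin
    (+ 1 ℤ.* + suc dm ℤ.+ + p ℤ.* + 4) ℤ.* + C  ≡⟨ cong (λ a → (a ℤ.+ + p ℤ.* + 4) ℤ.* + C) (ℤ.*-identityˡ (+ suc dm)) ⟩
    (+ suc dm ℤ.+ + p ℤ.* + 4) ℤ.* + C          ≡⟨ cong (λ a → (+ suc dm ℤ.+ a) ℤ.* + C) (ℤ.pos-* p 4) ⟨
    (+ suc dm ℤ.+ + (p * 4)) ℤ.* + C            ≡⟨ cong (ℤ._* + C) (ℤ.pos-+ (suc dm) (p * 4)) ⟨
    + (suc dm + p * 4) ℤ.* + C                  ≡⟨ ℤ.pos-* (suc dm + p * 4) C ⟨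
    + ((suc dm + p * 4) * C)                    ∎
    where open ≡-Reasoning

  ↧-quarter+-scaled : ∀ z dm C → ℚᵘ.↧ (quarter+-scaled z dm C) ≡ + (4 * suc dm)
  ↧-quarter+-scaled z dm C = cong +_ (*-identityʳ (4 * suc dm))

  ℕ→ℚ-≤-quarter+ : ∀ p dm .(c : Coprimality.Coprime p (suc dm)) N C →
    N * (4 * suc dm) ≤ (suc dm + p * 4) * C → ℕ→ℚ N ℚ.≤ (quarter ℚ.+ mkℚ (+ p) dm c) ℚ.* ℕ→ℚ C
  ℕ→ℚ-≤-quarter+ p dm c N C N≤ =
    ℚ.toℚᵘ-cancel-≤ (ℚᵘ.≤-respʳ-≃ (ℚᵘ.≃-sym (toℚᵘ-quarter+ (+ p) dm c C))
      (subst (ℚᵘ._≤ quarter+-scaled (+ p) dm C) (sym (toℚᵘ-ℕ→ℚ N)) (*≤* cross)))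
    where
    open ℤ.≤-Reasoning
    cross : + N ℤ.* ℚᵘ.↧ (quarter+-scaled (+ p) dm C) ℤ.≤ ℚᵘ.↥ (quarter+-scaled (+ p) dm C) ℤ.* + 1
    cross = begin
      + N ℤ.* ℚᵘ.↧ (quarter+-scaled (+ p) dm C)   ≡⟨ cong (+ N ℤ.*_) (↧-quarter+-scaled (+ p) dm C) ⟩
      + N ℤ.* + (4 * suc dm)                      ≡⟨ ℤ.pos-* N (4 * suc dm) ⟨
      + (N * (4 * suc dm))                        ≤⟨ +≤+ N≤ ⟩
      + ((suc dm + p * 4) * C)                    ≡⟨ ↥-quarter+-scaled p dm C ⟨
      ℚᵘ.↥ (quarter+-scaled (+ p) dm C)           ≡⟨ ℤ.*-identityʳ _ ⟨
      ℚᵘ.↥ (quarter+-scaled (+ p) dm C) ℤ.* + 1   ∎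

  quarter-≤-ℕ→ℚ : ∀ k dm .(c : Coprimality.Coprime (suc k) (suc dm)) N C →
    C ≤ 4 * N → (quarter ℚ.- mkℚ +[1+ k ] dm c) ℚ.* ℕ→ℚ C ℚ.≤ ℕ→ℚ N
  quarter-≤-ℕ→ℚ k dm c N C C≤4N =
    ℚ.toℚᵘ-cancel-≤ (ℚᵘ.≤-respˡ-≃ (ℚᵘ.≃-sym (toℚᵘ-quarter+ -[1+ k ] dm c C))
      (subst (quarter+-scaled -[1+ k ] dm C ℚᵘ.≤_) (sym (toℚᵘ-ℕ→ℚ N)) (*≤* cross)))
    where
    open ℤ.≤-Reasoning
    negative : -[1+ k ] ℤ.* + 4 ℤ.≤ + 0
    negative = -≤+
    rearrange : ∀ q N → q * (4 * N) ≡ N * (4 * q)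
    rearrange = solve-∀
    cross : ℚᵘ.↥ (quarter+-scaled -[1+ k ] dm C) ℤ.* + 1 ℤ.≤ + N ℤ.* ℚᵘ.↧ (quarter+-scaled -[1+ k ] dm C)
    cross = begin
      (+ 1 ℤ.* + suc dm ℤ.+ -[1+ k ] ℤ.* + 4) ℤ.* + C ℤ.* + 1 ≡⟨ ℤ.*-identityʳ _ ⟩
      (+ 1 ℤ.* + suc dm ℤ.+ -[1+ k ] ℤ.* + 4) ℤ.* + C         ≤⟨ ℤ.*-monoʳ-≤-nonNeg (+ C) (ℤ.+-monoʳ-≤ (+ 1 ℤ.* + suc dm) negative) ⟩
      (+ 1 ℤ.* + suc dm ℤ.+ + 0) ℤ.* + C                      ≡⟨ cong (ℤ._* + C) (ℤ.+-identityʳ (+ 1 ℤ.* + suc dm)) ⟩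
      + 1 ℤ.* + suc dm ℤ.* + C                                ≡⟨ cong (ℤ._* + C) (ℤ.*-identityˡ (+ suc dm)) ⟩
      + suc dm ℤ.* + C                                        ≡⟨ ℤ.pos-* (suc dm) C ⟨
      + (suc dm * C)                                          ≤⟨ +≤+ (*-monoʳ-≤ (suc dm) C≤4N) ⟩
      + (suc dm * (4 * N))                                    ≡⟨ cong +_ (rearrange (suc dm) N) ⟩
      + (N * (4 * suc dm))                                    ≡⟨ ℤ.pos-* N (4 * suc dm) ⟩
      + N ℤ.* + (4 * suc dm)                                  ≡⟨ cong (+ N ℤ.*_) (↧-quarter+-scaled -[1+ k ] dm C) ⟨
      + N ℤ.* ℚᵘ.↧ (quarter+-scaled -[1+ k ] dm C)            ∎

  2*C₂ : ∀ m → 2 * (suc m C 2) ≡ suc m * m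
  2*C₂ zero    = refl
  2*C₂ (suc m) = begin
    2 * (suc (suc m) C 2)              ≡⟨ cong (2 *_) (nCk+nC[k+1]≡[n+1]C[k+1] (suc m) 1) ⟨
    2 * (suc m C 1 + suc m C 2)        ≡⟨ cong (λ c → 2 * (c + suc m C 2)) (nC1≡n (suc m)) ⟩
    2 * (suc m + suc m C 2)            ≡⟨ *-distribˡ-+ 2 (suc m) (suc m C 2) ⟩
    2 * suc m + 2 * (suc m C 2)        ≡⟨ cong (λ c → 2 * suc m + c) (2*C₂ m) ⟩
    2 * suc m + suc m * m              ≡⟨ expand m ⟩
    suc (suc m) * suc m                ∎
    where
    open ≡-Reasoning
    expand : ∀ m → 2 * suc m + suc m * m ≡ suc (suc m) * suc m
    expand = solve-∀

  6*C₃ : ∀ m → 6 * (suc (suc m) C 3) ≡ suc (suc m) * suc m * m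
  6*C₃ zero    = refl
  6*C₃ (suc m) = begin
    6 * (suc M C 3)                   ≡⟨ cong (6 *_) (nCk+nC[k+1]≡[n+1]C[k+1] M 2) ⟨
    6 * (M C 2 + M C 3)               ≡⟨ *-distribˡ-+ 6 (M C 2) (M C 3) ⟩
    6 * (M C 2) + 6 * (M C 3)         ≡⟨ cong₂ _+_ (*-assoc 3 2 (M C 2)) (6*C₃ m) ⟩
    3 * (2 * (M C 2)) + M * suc m * m ≡⟨ cong (λ c → 3 * c + M * suc m * m) (2*C₂ (suc m)) ⟩
    3 * (M * suc m) + M * suc m * m   ≡⟨ expand m ⟩
    suc M * M * suc m                 ∎
    where
    open ≡-Reasoning
    M = suc (suc m)
    expand : ∀ m → 3 * (suc (suc m) * suc m) + suc (suc m) * suc m * m ≡ suc (suc (suc m)) * suc (suc m) * suc m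
    expand = solve-∀

  cube-≤ : ∀ q j → let m = 4 + q + j ; n = suc (suc m) in q * (n * (n * n)) ≤ (q + 4) * (n * suc m * m)
  cube-≤ q j = ≤-trans (m≤m+n _ _) (≤-reflexive (expand q j))
    where
    expand : ∀ q j → let m = 4 + q + j ; n = suc (suc m) in
      q * (n * (n * n)) + n * (m * (4 * j + q + 16) + 4 * j + 16) ≡ (q + 4) * (n * suc m * m)
    expand = solve-∀

  n³-bound⇒C₃-bound : ∀ N n {q p} → 6 + q ≤ n → 1 ≤ p → 24 * N ≤ n * (n * n) → N * (4 * q) ≤ (q + p * 4) * (n C 3)
  n³-bound⇒C₃-bound N n {q} {p} 6+q≤n 1≤p 24N≤n³ with m≤n⇒∃[o]m+o≡n 6+q≤n
  ... | j , refl = *-cancelˡ-≤ 6 (begin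
    6 * (N * (4 * q))              ≡⟨ regroup N q ⟩
    q * (24 * N)                   ≤⟨ *-monoʳ-≤ q 24N≤n³ ⟩
    q * (n′ * (n′ * n′))           ≤⟨ cube-≤ q j ⟩
    (q + 4) * (n′ * suc m * m)     ≡⟨ cong ((q + 4) *_) (6*C₃ m) ⟨
    (q + 4) * (6 * (n′ C 3))       ≤⟨ *-monoˡ-≤ (6 * (n′ C 3)) (+-monoʳ-≤ q (*-monoˡ-≤ 4 1≤p)) ⟩
    (q + p * 4) * (6 * (n′ C 3))   ≡⟨ swap (q + p * 4) (n′ C 3) ⟩
    6 * ((q + p * 4) * (n′ C 3))   ∎)
    where
    open ≤-Reasoning
    m = 4 + q + j
    n′ = suc (suc m)
    regroup : ∀ N q → 6 * (N * (4 * q)) ≡ q * (24 * N)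
    regroup = solve-∀
    swap : ∀ a b → a * (6 * b) ≡ 6 * (a * b)
    swap = solve-∀

open import Data.Nat using (ℕ; suc; _≥_; z≤n; s≤s)
import Data.Nat as ℕ
open import Data.Nat.Properties using (≤-refl)
open import Data.Nat.Combinatorics using (_C_)
open import Data.Integer using (+_; -[1+_]; +[1+_]; +<+)
open import Data.Product using (Σ; _×_; _,_)
open import Data.Rational using (ℚ; mkℚ; _+_; _-_; _*_; _≤_; _<_; 0ℚ; *<*)
open TopologicalOrder using (topologicalNumbering)
open LowerBound using (alternating; alternating-acyclic; C₃≤4*Nind)
open Asymptotics using (ℕ→ℚ-≤-quarter+; quarter-≤-ℕ→ℚ; n³-bound⇒C₃-bound)

dag-24*Nind≤n³ : ∀ {n} {E : Digraph n} → IsDAG E → 24 ℕ.* Nind-DP3 E ℕ.≤ n ℕ.* (n ℕ.* n)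
dag-24*Nind≤n³ {E = E} dag = UpperBound.24*Nind≤n³ E (topologicalNumbering dag)

eventually-≤ : (ε : ℚ) → 0ℚ < ε → Σ ℕ λ N → (n : ℕ) → n ≥ N → (H : Digraph n) → IsDAG H →
  ℕ→ℚ (Nind-DP3 H) ≤ (quarter + ε) * ℕ→ℚ (n C 3)
eventually-≤ (mkℚ (+ 0)    _  _) (*<* (+<+ ()))
eventually-≤ (mkℚ -[1+ _ ] _  _) (*<* ())
eventually-≤ (mkℚ +[1+ k ] dm c) _ = 6 ℕ.+ suc dm , λ n n≥ H dag →
  ℕ→ℚ-≤-quarter+ (suc k) dm c (Nind-DP3 H) (n C 3)
    (n³-bound⇒C₃-bound (Nind-DP3 H) n {p = suc k} n≥ (s≤s z≤n) (dag-24*Nind≤n³ dag))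

frequently-≥ : (ε : ℚ) → 0ℚ < ε → (N : ℕ) → Σ ℕ λ n → n ≥ N × Σ (Digraph n) λ H → IsDAG H ×
  (quarter - ε) * ℕ→ℚ (n C 3) ≤ ℕ→ℚ (Nind-DP3 H)
frequently-≥ (mkℚ (+ 0)    _  _) (*<* (+<+ ()))
frequently-≥ (mkℚ -[1+ _ ] _  _) (*<* ())
frequently-≥ (mkℚ +[1+ k ] dm c) _ N = N , ≤-refl , alternating , alternating-acyclic ,
  quarter-≤-ℕ→ℚ k dm c (Nind-DP3 (alternating {N})) (N C 3) (C₃≤4*Nind N)

theoremA1 :
    ((ε : ℚ) → 0ℚ < ε → Σ ℕ λ N → (n : ℕ) → n ≥ N → (H : Digraph n) → IsDAG H →
      ℕ→ℚ (Nind-DP3 H) ≤ (quarter + ε) * ℕ→ℚ (n C 3))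
    ×
    ((ε : ℚ) → 0ℚ < ε → (N : ℕ) → Σ ℕ λ n → n ≥ N × Σ (Digraph n) λ H → IsDAG H ×
      (quarter - ε) * ℕ→ℚ (n C 3) ≤ ℕ→ℚ (Nind-DP3 H))
theoremA1 = eventually-≤ , frequently-≥
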